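{- Let $n\in\mathbb{N}$ and $\alpha=(a_1,\dots,a_n)\in[n]^n$. Then $\alpha\in\mathrm{PF}_n(1)$ if and only if both of the following hold: (1) there exist $j\in[n-1]$ and distinct $k,k'\in[n]$ such that $a_k=a_{k'}=j$ and $a_i\neq j$ for every index $i\neq k,k'$; and (2) $\{a_i : i\in[n],\ i\neq k,k'\}=[n]\setminus\{j,j+1\}$.
   Context: $[m]=\{1,\dots,m\}$. Parking functions: $n$ cars numbered $1,\dots,n$ enter in order a one-way street with spots $1,\dots,n$. Given a preference vector $\alpha=(a_1,\dots,a_n)\in[n]^n$, car $i$ drives to spot $a_i$ and parks there if it is free; otherwise it parks in the first free spot after $a_i$ (if none exists, it fails to park). $\alpha$ is a parking function of length $n$ if all cars park. If car $i$ parks in spot $p_i$, its displacement is $p_i-a_i$, and the displacement of $\alpha$ is the sum of the displacements of all cars. $\mathrm{PF}_n(1)$ is the set of parking functions of length $n$ with displacement exactly $1$. -}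

module Defs where

open import Data.Nat using (ℕ; zero; suc; _∸_; _≟_)
open import Data.Bool using (if_then_else_)
open import Data.List using (List; []; _∷_; zipWith)
open import Data.Nat.ListAction using (sum)
open import Data.List.Membership.DecPropositional _≟_ using (_∈?_)
open import Data.Maybe using (Maybe; just; nothing)
import Data.Maybe as Maybe
open import Data.Fin using (Fin)
open import Data.Vec.Functional using (toList)
open import Data.Product using (∃; _×_)
open import Relation.Nullary using (does)
open import Relation.Binary.PropositionalEquality using (_≡_)

-- Spots and preferences are 1-indexed natural numbers (spots 1..n).
-- findSpot k s occ: the first spot among s, s+1, ..., s+k-1 not in the
-- list `occ` of occupied spots (nothing if all are occupied).
findSpot : ℕ → ℕ → List ℕ → Maybe ℕ
findSpot zero    s occ = nothing
findSpot (suc k) s occ = if does (s ∈? occ) then findSpot k (suc s) occ else just s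

-- Run the parking process on a street with spots 1..n: cars arrive in the
-- order of the list, a car with preference a tries spots a, a+1, ..., n.
parkFrom : ℕ → List ℕ → List ℕ → Maybe (List ℕ)
parkFrom n occ [] = just []
parkFrom n occ (a ∷ as) with findSpot (suc n ∸ a) a occ
... | nothing = nothing
... | just p  = Maybe.map (p ∷_) (parkFrom n (p ∷ occ) as)

parkingOutcome : (n : ℕ) → (Fin n → ℕ) → Maybe (List ℕ)
parkingOutcome n α = parkFrom n [] (toList α)

PFWithDisplacement : (n : ℕ) → ℕ → (Fin n → ℕ) → Set
PFWithDisplacement n d α =
  ∃ λ ps → parkingOutcome n α ≡ just ps × sum (zipWith _∸_ ps (toList α)) ≡ d

PF1 : (n : ℕ) → (Fin n → ℕ) → Set
PF1 n α = PFWithDisplacement n 1 α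

{-# OPTIONS --safe #-}

-- The cars of a parking function occupy each spot 1..n exactly once, so total displacement 1
-- means that every car parks at its preference except one, which prefers a spot j that is
-- already taken and parks at j+1. Thus the preferences form the multiset {1..n} with j+1
-- replaced by j. Conversely, for such preferences every other car parks in place and the two
-- cars preferring j take j and j+1. Conditions (1) and (2) say the same thing, because a list
-- of length n in 1..n whose counts dominate another such list has the same counts: summing
-- the counts over 1..n gives n on both sides.
module Submission where

open import Defs
open import Data.Bool using (if_then_else_)
open import Data.Nat using (ℕ; zero; suc; _≤_; _<_; _∸_; _+_; _≟_; z≤n; s≤s)
open import Data.Nat.Properties
open import Algebra.Properties.CommutativeSemigroup +-commutativeSemigroup
  using (interchange; x∙yz≈y∙xz)
open import Data.Nat.ListAction using (sum)
open import Data.Fin using (Fin) renaming (zero to fzero; suc to fsuc)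
import Data.Fin.Properties as Fin
open import Data.Product using (∃; ∃₂; ∃-syntax; _×_; _,_; proj₁; proj₂; uncurry)
open import Data.Sum using (_⊎_; inj₁; inj₂)
open import Data.List using (List; []; _∷_; length; map; zipWith; tabulate)
open import Data.List.Properties using (length-tabulate)
open import Data.List.Relation.Unary.Any using (here; there)
open import Data.List.Membership.Propositional using (_∈_; _∉_)
open import Data.List.Membership.Propositional.Properties using (∈-tabulate⁺; ∈-tabulate⁻)
open import Data.List.Membership.DecPropositional _≟_ using (_∈?_)
open import Data.Maybe using (just)
open import Function using (_∘_)
open import Function.Bundles using (_⇔_; mk⇔; Equivalence)
import Function.Properties.Equivalence as ⇔
open import Relation.Nullary using (yes; no; does; contradiction)
open import Relation.Nullary.Decidable using (dec-true; dec-false)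
open import Relation.Binary.PropositionalEquality

δ : ℕ → ℕ → ℕ
δ v x = if does (v ≟ x) then 1 else 0

δ-refl : ∀ v → δ v v ≡ 1
δ-refl v = cong (λ b → if b then 1 else 0) (dec-true (v ≟ v) refl)

δ-≢ : ∀ {v x} → v ≢ x → δ v x ≡ 0
δ-≢ {v} {x} v≢x = cong (λ b → if b then 1 else 0) (dec-false (v ≟ x) v≢x)

δ-sym : ∀ v x → δ v x ≡ δ x v
δ-sym v x with v ≟ x
... | yes refl = refl
... | no v≢x   = trans (δ-≢ v≢x) (sym (δ-≢ (v≢x ∘ sym)))

sumOver : (ℕ → ℕ) → List ℕ → ℕ
sumOver f xs = sum (map f xs)

sumOver-+ : ∀ f g xs → sumOver (λ v → f v + g v) xs ≡ sumOver f xs + sumOver g xs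
sumOver-+ f g []       = refl
sumOver-+ f g (x ∷ xs) =
  trans (cong ((f x + g x) +_) (sumOver-+ f g xs)) (interchange (f x) (g x) (sumOver f xs) (sumOver g xs))

sumOver-cong : ∀ {f g} xs → (∀ v → v ∈ xs → f v ≡ g v) → sumOver f xs ≡ sumOver g xs
sumOver-cong []       _   = refl
sumOver-cong (x ∷ xs) f≡g = cong₂ _+_ (f≡g x (here refl)) (sumOver-cong xs (λ v → f≡g v ∘ there))

sumOver-mono : ∀ {f g} xs → (∀ v → v ∈ xs → f v ≤ g v) → sumOver f xs ≤ sumOver g xs
sumOver-mono []       _   = z≤n
sumOver-mono (x ∷ xs) f≤g = +-mono-≤ (f≤g x (here refl)) (sumOver-mono xs (λ v → f≤g v ∘ there))

sumOver-squeeze : ∀ {f g} xs → (∀ v → v ∈ xs → f v ≤ g v) → sumOver g xs ≤ sumOver f xs →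
                  ∀ v → v ∈ xs → f v ≡ g v
sumOver-squeeze {f} {g} (x ∷ xs) f≤g Σg≤Σf v v∈ = agree v v∈
  where
  F G : ℕ
  F = sumOver f xs
  G = sumOver g xs
  F≤G : F ≤ G
  F≤G = sumOver-mono xs (λ w → f≤g w ∘ there)
  fx≤gx : f x ≤ g x
  fx≤gx = f≤g x (here refl)
  gx≤fx : g x ≤ f x
  gx≤fx = +-cancelʳ-≤ G (g x) (f x) (≤-trans Σg≤Σf (+-monoʳ-≤ (f x) F≤G))
  G≤F : G ≤ F
  G≤F = +-cancelˡ-≤ (g x) G F (≤-trans Σg≤Σf (+-monoˡ-≤ F fx≤gx))
  agree : ∀ v → v ∈ x ∷ xs → f v ≡ g v
  agree v (here refl) = ≤-antisym fx≤gx gx≤fx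
  agree v (there v∈)  = sumOver-squeeze xs (λ w → f≤g w ∘ there) G≤F v v∈

sumOver-const-1 : ∀ xs → sumOver (λ _ → 1) xs ≡ length xs
sumOver-const-1 []       = refl
sumOver-const-1 (x ∷ xs) = cong suc (sumOver-const-1 xs)

sumOver-const-0 : ∀ xs → sumOver (λ _ → 0) xs ≡ 0
sumOver-const-0 []       = refl
sumOver-const-0 (x ∷ xs) = sumOver-const-0 xs

sumOver-swap : ∀ (g : ℕ → ℕ → ℕ) xs ys →
               sumOver (λ v → sumOver (g v) xs) ys ≡ sumOver (λ x → sumOver (λ v → g v x) ys) xs
sumOver-swap g []       ys = sumOver-const-0 ys
sumOver-swap g (x ∷ xs) ys =
  trans (sumOver-+ (λ v → g v x) (λ v → sumOver (g v) xs) ys) (cong (_ +_) (sumOver-swap g xs ys))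

count : ℕ → List ℕ → ℕ
count v = sumOver (δ v)

count-∷-≡ : ∀ {v x} xs → v ≡ x → count v (x ∷ xs) ≡ suc (count v xs)
count-∷-≡ {v} xs refl = cong (_+ count v xs) (δ-refl v)

count-∷-≢ : ∀ {v x} xs → v ≢ x → count v (x ∷ xs) ≡ count v xs
count-∷-≢ {v} xs v≢x = cong (_+ count v xs) (δ-≢ v≢x)

count-≤-∷ : ∀ {v} x xs → count v xs ≤ count v (x ∷ xs)
count-≤-∷ {v} x xs = m≤n+m (count v xs) (δ v x)

count-∈ : ∀ {v xs} → v ∈ xs → 1 ≤ count v xs
count-∈ {v} {x ∷ xs} (here refl) = subst (1 ≤_) (sym (count-∷-≡ {v} xs refl)) (s≤s z≤n)
count-∈ {v} {x ∷ xs} (there v∈)  = ≤-trans (count-∈ v∈) (count-≤-∷ {v} x xs)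

count-∉ : ∀ {v xs} → v ∉ xs → count v xs ≡ 0
count-∉ {v} {[]}     _   = refl
count-∉ {v} {x ∷ xs} v∉ = trans (count-∷-≢ xs (v∉ ∘ here)) (count-∉ (v∉ ∘ there))

count⇒∈ : ∀ {v xs} → 1 ≤ count v xs → v ∈ xs
count⇒∈ {v} {xs} 1≤c with v ∈? xs
... | yes v∈ = v∈
... | no  v∉ = contradiction (subst (1 ≤_) (count-∉ v∉) 1≤c) λ ()

∉-∷ : ∀ {x y : ℕ} {ys} → x ≢ y → x ∉ ys → x ∉ y ∷ ys
∉-∷ x≢y _   (here x≡y) = x≢y x≡y
∉-∷ _   x∉ (there x∈) = x∉ x∈

count≤1⇒∉ : ∀ {x xs} → count x (x ∷ xs) ≤ 1 → x ∉ xs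
count≤1⇒∉ {x} {xs} ≤1 x∈ = 1+n≰n (≤-trans (s≤s (count-∈ x∈)) (subst (_≤ 1) (count-∷-≡ {x} xs refl) ≤1))

record _≈_ (xs ys : List ℕ) : Set where
  constructor count-≡
  field counts : ∀ v → count v xs ≡ count v ys

infix 4 _≈_
open _≈_

≈-trans : ∀ {xs ys zs} → xs ≈ ys → ys ≈ zs → xs ≈ zs
≈-trans xs≈ys ys≈zs = count-≡ λ v → trans (counts xs≈ys v) (counts ys≈zs v)

≈-sym : ∀ {xs ys} → xs ≈ ys → ys ≈ xs
≈-sym xs≈ys = count-≡ λ v → sym (counts xs≈ys v)

∷-cong : ∀ {x xs ys} → xs ≈ ys → x ∷ xs ≈ x ∷ ys
∷-cong {x} xs≈ys = count-≡ λ v → cong (δ v x +_) (counts xs≈ys v)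

∷-swap : ∀ x y xs → x ∷ y ∷ xs ≈ y ∷ x ∷ xs
∷-swap x y xs = count-≡ λ v → x∙yz≈y∙xz (δ v x) (δ v y) (count v xs)

≈-∷⇒∈ : ∀ {x y xs ys} → x ∷ xs ≈ y ∷ ys → x ≢ y → x ∈ ys
≈-∷⇒∈ {x} {y} {xs} {ys} eq x≢y = count⇒∈ (begin
  1                     ≤⟨ s≤s z≤n ⟩
  suc (count x xs)      ≡⟨ count-∷-≡ {x} xs refl ⟨
  count x (x ∷ xs)      ≡⟨ counts eq x ⟩
  count x (y ∷ ys)      ≡⟨ count-∷-≢ ys x≢y ⟩
  count x ys            ∎)
  where open ≤-Reasoning

InRange : ℕ → List ℕ → Set
InRange n xs = ∀ x → x ∈ xs → 1 ≤ x × x ≤ n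

InRange-∷ : ∀ {n x xs} → 1 ≤ x × x ≤ n → InRange n xs → InRange n (x ∷ xs)
InRange-∷ x-in _    _ (here refl) = x-in
InRange-∷ _    xsIn y (there y∈)  = xsIn y y∈

InRange-tabulate : ∀ {n m} {f : Fin m → ℕ} → (∀ i → 1 ≤ f i × f i ≤ n) → InRange n (tabulate f)
InRange-tabulate {n} f-in x x∈ with ∈-tabulate⁻ x∈
... | i , refl = f-in i

spots : ℕ → List ℕ
spots zero    = []
spots (suc n) = suc n ∷ spots n

length-spots : ∀ n → length (spots n) ≡ n
length-spots zero    = refl
length-spots (suc n) = cong suc (length-spots n)

spots-InRange : ∀ n → InRange n (spots n)
spots-InRange (suc n) _ (here refl) = s≤s z≤n , ≤-refl
spots-InRange (suc n) v (there v∈)  with spots-InRange n v v∈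
... | 1≤v , v≤n = 1≤v , m≤n⇒m≤1+n v≤n

∈-spots : ∀ {v} n → 1 ≤ v → v ≤ n → v ∈ spots n
∈-spots {suc _} zero _ ()
∈-spots {v} (suc n) 1≤v v≤1+n with v ≟ suc n
... | yes refl = here refl
... | no  v≢   = there (∈-spots n 1≤v (≤-pred (≤∧≢⇒< v≤1+n v≢)))

count-spots : ∀ {v} n → 1 ≤ v → v ≤ n → count v (spots n) ≡ 1
count-spots {suc _} zero _ ()
count-spots {v} (suc n) 1≤v v≤1+n with v ≟ suc n
... | yes refl =
  trans (count-∷-≡ {v} (spots n) refl) (cong suc (count-∉ (1+n≰n ∘ proj₂ ∘ spots-InRange n v)))
... | no  v≢   = trans (count-∷-≢ (spots n) v≢) (count-spots n 1≤v (≤-pred (≤∧≢⇒< v≤1+n v≢)))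

count-spots-≤1 : ∀ v n → count v (spots n) ≤ 1
count-spots-≤1 v n with v ∈? spots n
... | yes v∈ = ≤-reflexive (uncurry (count-spots n) (spots-InRange n v v∈))
... | no  v∉ = ≤-trans (≤-reflexive (count-∉ v∉)) z≤n

sumOver-count-spots : ∀ n xs → InRange n xs → sumOver (λ v → count v xs) (spots n) ≡ length xs
sumOver-count-spots n xs inRange = begin
  sumOver (λ v → count v xs) (spots n)                 ≡⟨ sumOver-swap δ xs (spots n) ⟩
  sumOver (λ x → sumOver (λ v → δ v x) (spots n)) xs  ≡⟨ sumOver-cong xs once ⟩
  sumOver (λ _ → 1) xs                                 ≡⟨ sumOver-const-1 xs ⟩
  length xs                                            ∎
  where
  open ≡-Reasoning
  once : ∀ x → x ∈ xs → sumOver (λ v → δ v x) (spots n) ≡ 1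
  once x x∈ = trans (sumOver-cong (spots n) (λ v _ → δ-sym v x))
                    (count-spots n (proj₁ (inRange x x∈)) (proj₂ (inRange x x∈)))

count-≤⇒≈ : ∀ n {xs ys} → InRange n xs → InRange n ys → length xs ≡ length ys →
               (∀ v → 1 ≤ v → v ≤ n → count v xs ≤ count v ys) → xs ≈ ys
count-≤⇒≈ n {xs} {ys} xsIn ysIn len xs≤ys = count-≡ agree
  where
  xs≤ys′ : ∀ w → w ∈ spots n → count w xs ≤ count w ys
  xs≤ys′ w w∈ = uncurry (xs≤ys w) (spots-InRange n w w∈)
  Σys≤Σxs : sumOver (λ w → count w ys) (spots n) ≤ sumOver (λ w → count w xs) (spots n)
  Σys≤Σxs = ≤-reflexive (trans (sumOver-count-spots n ys ysIn)
                          (trans (sym len) (sym (sumOver-count-spots n xs xsIn))))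
  outside : ∀ {v zs} → v ∉ spots n → InRange n zs → count v zs ≡ 0
  outside {v} v∉ zsIn = count-∉ λ v∈ → v∉ (uncurry (∈-spots n) (zsIn v v∈))
  agree : ∀ v → count v xs ≡ count v ys
  agree v with v ∈? spots n
  ... | yes v∈ = sumOver-squeeze (spots n) xs≤ys′ Σys≤Σxs v v∈
  ... | no  v∉ = trans (outside v∉ xsIn) (sym (outside v∉ ysIn))

findSpot-free : ∀ k {s occ} → s ∉ occ → findSpot (suc k) s occ ≡ just s
findSpot-free k {s} {occ} s∉ with s ∈? occ
... | yes s∈ = contradiction s∈ s∉
... | no  _  = refl

findSpot-taken : ∀ k {s occ} → s ∈ occ → findSpot (suc k) s occ ≡ findSpot k (suc s) occ
findSpot-taken k {s} {occ} s∈ with s ∈? occ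
... | yes _  = refl
... | no  s∉ = contradiction s∈ s∉

findSpot-sound : ∀ k s occ {p} → findSpot k s occ ≡ just p →
                 (s ≤ p × p < s + k) × p ∉ occ × (p ≡ s ⊎ s ∈ occ)
findSpot-sound (suc k) s occ {p} found with s ∈? occ
findSpot-sound (suc k) s occ refl | no s∉ =
  (≤-refl , subst (s <_) (sym (+-suc s k)) (s≤s (m≤m+n s k))) , s∉ , inj₁ refl
... | yes s∈ with findSpot-sound k (suc s) occ found
...   | (s<p , p<1+s+k) , p∉ , _ =
  (<⇒≤ s<p , subst (p <_) (sym (+-suc s k)) p<1+s+k) , p∉ , inj₂ s∈

Parks : ℕ → List ℕ → List ℕ → ℕ → Set
Parks n occ as d = ∃ λ ps → parkFrom n occ as ≡ just ps × sum (zipWith _∸_ ps as) ≡ d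

parkFrom-∷⁻ : ∀ n occ a as {ps} → parkFrom n occ (a ∷ as) ≡ just ps →
  ∃₂ λ p ps′ → findSpot (suc n ∸ a) a occ ≡ just p × parkFrom n (p ∷ occ) as ≡ just ps′ × ps ≡ p ∷ ps′
parkFrom-∷⁻ n occ a as parked with findSpot (suc n ∸ a) a occ
... | just p with parkFrom n (p ∷ occ) as in rest
...   | just ps′ with refl ← parked = p , ps′ , refl , rest , refl

Parks-∷ : ∀ {n occ a as p d} → findSpot (suc n ∸ a) a occ ≡ just p →
          Parks n (p ∷ occ) as d → Parks n occ (a ∷ as) (p ∸ a + d)
Parks-∷ {a = a} {d = d} found (ps , parked , disp) rewrite found | parked = _ , refl , cong (_ +_) disp

parks-in-place : ∀ {n occ a as d} → a ∉ occ → a ≤ n → Parks n (a ∷ occ) as d → Parks n occ (a ∷ as) d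
parks-in-place {n} {occ} {a} {as} {d} a∉ a≤n rest =
  subst (Parks n occ (a ∷ as)) (cong (_+ d) (n∸n≡0 a)) (Parks-∷ found rest)
  where
  found : findSpot (suc n ∸ a) a occ ≡ just a
  found rewrite +-∸-assoc 1 a≤n = findSpot-free (n ∸ a) a∉

parks-next : ∀ {n occ a as d} → a ∈ occ → suc a ∉ occ → suc a ≤ n →
             Parks n (suc a ∷ occ) as d → Parks n occ (a ∷ as) (suc d)
parks-next {n} {occ} {a} {as} {d} a∈ 1+a∉ 1+a≤n rest =
  subst (Parks n occ (a ∷ as)) (cong (_+ d) (m+n∸n≡m 1 a)) (Parks-∷ found rest)
  where
  found : findSpot (suc n ∸ a) a occ ≡ just (suc a)
  found rewrite +-∸-assoc 1 (<⇒≤ 1+a≤n) | +-∸-assoc 1 1+a≤n =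
    trans (findSpot-taken (suc (n ∸ suc a)) a∈) (findSpot-free (n ∸ suc a) 1+a∉)

parkFrom-outcome : ∀ {n occ as ps} → InRange n as → parkFrom n occ as ≡ just ps →
  length ps ≡ length as × InRange n ps × (∀ v → count v ps ≤ 1) × (∀ v → v ∈ occ → v ∉ ps)
parkFrom-outcome {as = []} _ refl = refl , (λ _ ()) , (λ _ → z≤n) , (λ _ _ ())
parkFrom-outcome {n} {occ} {a ∷ as} asIn parked with parkFrom-∷⁻ n occ a as parked
... | p , ps , found , rest , refl
    with findSpot-sound (suc n ∸ a) a occ found | parkFrom-outcome (λ x → asIn x ∘ there) rest
...   | (a≤p , p<a+k) , p∉ , _ | len , psIn , distinct , disjoint =
  cong suc len , p∷psIn , p∷distinct , p∷disjoint
  where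
  1≤a×a≤n : 1 ≤ a × a ≤ n
  1≤a×a≤n = asIn a (here refl)
  p∷psIn : InRange n (p ∷ ps)
  p∷psIn _ (here refl) =
    ≤-trans (proj₁ 1≤a×a≤n) a≤p , ≤-pred (subst (p <_) (m+[n∸m]≡n (m≤n⇒m≤1+n (proj₂ 1≤a×a≤n))) p<a+k)
  p∷psIn v (there v∈) = psIn v v∈
  p∷distinct : ∀ v → count v (p ∷ ps) ≤ 1
  p∷distinct v with v ≟ p
  ... | yes refl =
    ≤-reflexive (trans (count-∷-≡ {v} ps refl) (cong suc (count-∉ (disjoint v (here refl)))))
  ... | no  v≢p  = ≤-trans (≤-reflexive (count-∷-≢ ps v≢p)) (distinct v)
  p∷disjoint : ∀ v → v ∈ occ → v ∉ p ∷ ps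
  p∷disjoint v v∈ (here refl) = p∉ v∈
  p∷disjoint v v∈ (there v∈ps) = disjoint v (there v∈) v∈ps

parkFrom-displacement-0 : ∀ {n occ as ps} → parkFrom n occ as ≡ just ps →
                          sum (zipWith _∸_ ps as) ≡ 0 → ps ≡ as
parkFrom-displacement-0 {as = []} refl _ = refl
parkFrom-displacement-0 {n} {occ} {a ∷ as} parked disp with parkFrom-∷⁻ n occ a as parked
... | p , ps , found , rest , refl with findSpot-sound (suc n ∸ a) a occ found
...   | (a≤p , _) , _ =
  cong₂ _∷_ (≤-antisym (m∸n≡0⇒m≤n (m+n≡0⇒m≡0 (p ∸ a) disp)) a≤p)
            (parkFrom-displacement-0 rest (m+n≡0⇒n≡0 (p ∸ a) disp))

m+n≡1 : ∀ m {n} → m + n ≡ 1 → (m ≡ 0 × n ≡ 1) ⊎ (m ≡ 1 × n ≡ 0)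
m+n≡1 zero          m+n≡1 = inj₁ (refl , m+n≡1)
m+n≡1 (suc zero) {zero} _ = inj₂ (refl , refl)

parkFrom-displacement-1 : ∀ {n occ as ps} → parkFrom n occ as ≡ just ps →
  sum (zipWith _∸_ ps as) ≡ 1 → ∃ λ j → (j ∈ occ ⊎ j ∈ ps) × suc j ∷ as ≈ j ∷ ps
parkFrom-displacement-1 {as = []} refl ()
parkFrom-displacement-1 {n} {occ} {a ∷ as} parked disp with parkFrom-∷⁻ n occ a as parked
... | p , ps , found , rest , refl with findSpot-sound (suc n ∸ a) a occ found
...   | (a≤p , _) , _ , p≡a⊎a∈occ with m+n≡1 (p ∸ a) disp
...     | inj₁ (p∸a , disp′) =
  inPlace (≤-antisym (m∸n≡0⇒m≤n p∸a) a≤p) (parkFrom-displacement-1 rest disp′)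
  where
  inPlace : p ≡ a → ∃ (λ j → (j ∈ p ∷ occ ⊎ j ∈ ps) × suc j ∷ as ≈ j ∷ ps) →
            ∃ λ j → (j ∈ occ ⊎ j ∈ p ∷ ps) × suc j ∷ a ∷ as ≈ j ∷ p ∷ ps
  inPlace refl (j , j∈ , shift) = j , moved j∈ , ≈-trans (∷-swap (suc j) a as)
                                               (≈-trans (∷-cong shift) (∷-swap a j ps))
    where
    moved : j ∈ p ∷ occ ⊎ j ∈ ps → j ∈ occ ⊎ j ∈ p ∷ ps
    moved (inj₁ (here j≡p))  = inj₂ (here j≡p)
    moved (inj₁ (there j∈)) = inj₁ j∈
    moved (inj₂ j∈)         = inj₂ (there j∈)
...     | inj₂ (p∸a , disp′) = bumped p≡1+a (parkFrom-displacement-0 rest disp′) p≡a⊎a∈occ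
  where
  p≡1+a : p ≡ suc a
  p≡1+a = trans (sym (m∸n+n≡m a≤p)) (cong (_+ a) p∸a)
  bumped : p ≡ suc a → ps ≡ as → p ≡ a ⊎ a ∈ occ →
           ∃ λ j → (j ∈ occ ⊎ j ∈ p ∷ ps) × suc j ∷ a ∷ as ≈ j ∷ p ∷ ps
  bumped refl _    (inj₁ 1+a≡a) = contradiction 1+a≡a 1+n≢n
  bumped refl refl (inj₂ a∈)    = a , inj₁ a∈ , ∷-swap (suc a) a as

module Simulation (n j : ℕ) (1+j≤n : suc j ≤ n) where

  -- c is the number of cars preferring j that are still to come.
  data Pending (occ : List ℕ) : ℕ → Set where
    none : Pending occ 0
    one  : j ∈ occ → suc j ∉ occ → Pending occ 1
    two  : j ∉ occ → suc j ∉ occ → Pending occ 2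

  Pending-∷ : ∀ {occ c a} → a ≢ j → a ≢ suc j → Pending occ c → Pending (a ∷ occ) c
  Pending-∷ a≢j a≢1+j none          = none
  Pending-∷ a≢j a≢1+j (one j∈ 1+j∉) = one (there j∈) (∉-∷ (a≢1+j ∘ sym) 1+j∉)
  Pending-∷ a≢j a≢1+j (two j∉ 1+j∉) = two (∉-∷ (a≢j ∘ sym) j∉) (∉-∷ (a≢1+j ∘ sym) 1+j∉)

  owed : ℕ → ℕ
  owed zero    = 0
  owed (suc _) = 1

  OthersFree : List ℕ → List ℕ → Set
  OthersFree as occ = ∀ a → a ∈ as → a ≢ j → a ≢ suc j × a ∉ occ

  OthersDistinct : List ℕ → Set
  OthersDistinct as = ∀ a → a ≢ j → count a as ≤ 1

  OthersDistinct-tail : ∀ a as → OthersDistinct (a ∷ as) → OthersDistinct as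
  OthersDistinct-tail a as distinct x x≢j = ≤-trans (count-≤-∷ {x} a as) (distinct x x≢j)

  park : ∀ occ as c → count j as ≡ c → Pending occ c → InRange n as → OthersFree as occ →
         OthersDistinct as → Parks n occ as (owed c)
  park-j : ∀ occ as c → suc (count j as) ≡ c → Pending occ c → InRange n as → OthersFree as occ →
           OthersDistinct as → Parks n occ (j ∷ as) (owed c)

  park occ []       .0 refl none _ _ _ = [] , refl , refl
  park occ (a ∷ as) c  cnt pending asIn free distinct with a ≟ j
  ... | yes refl =
    park-j occ as c (trans (sym (count-∷-≡ {a} as refl)) cnt) pending
           (λ x → asIn x ∘ there) (λ x → free x ∘ there) (OthersDistinct-tail a as distinct)
  ... | no a≢j =
    parks-in-place a∉occ (proj₂ (asIn a (here refl)))
      (park (a ∷ occ) as c (trans (sym (count-∷-≢ as (a≢j ∘ sym))) cnt) (Pending-∷ a≢j a≢1+j pending)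
            (λ x → asIn x ∘ there) free′ (OthersDistinct-tail a as distinct))
    where
    a≢1+j : a ≢ suc j
    a≢1+j = proj₁ (free a (here refl) a≢j)
    a∉occ : a ∉ occ
    a∉occ = proj₂ (free a (here refl) a≢j)
    a∉as : a ∉ as
    a∉as = count≤1⇒∉ (distinct a a≢j)
    free′ : OthersFree as (a ∷ occ)
    free′ x x∈ x≢j = proj₁ (free x (there x∈) x≢j) ,
                     ∉-∷ (λ { refl → a∉as x∈ }) (proj₂ (free x (there x∈) x≢j))

  park-j occ as .1 cnt (one j∈ 1+j∉) asIn free distinct =
    parks-next j∈ 1+j∉ 1+j≤n (park (suc j ∷ occ) as 0 (suc-injective cnt) none asIn free′ distinct)
    where
    free′ : OthersFree as (suc j ∷ occ)
    free′ x x∈ x≢j = proj₁ (free x x∈ x≢j) , ∉-∷ (proj₁ (free x x∈ x≢j)) (proj₂ (free x x∈ x≢j))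
  park-j occ as .2 cnt (two j∉ 1+j∉) asIn free distinct =
    parks-in-place j∉ (<⇒≤ 1+j≤n)
      (park (j ∷ occ) as 1 (suc-injective cnt) (one (here refl) (∉-∷ 1+n≢n 1+j∉)) asIn free′ distinct)
    where
    free′ : OthersFree as (j ∷ occ)
    free′ x x∈ x≢j = proj₁ (free x x∈ x≢j) , ∉-∷ x≢j (proj₂ (free x x∈ x≢j))

-- As multisets, as = {1..n} with j+1 replaced by j, written with both sides moved so nothing is removed.
PF1Multiset : ℕ → List ℕ → Set
PF1Multiset n as = ∃[ j ] (1 ≤ j × suc j ≤ n) × suc j ∷ as ≈ j ∷ spots n

multiplicities : ∀ {n j as} → 1 ≤ j → suc j ≤ n → suc j ∷ as ≈ j ∷ spots n →
  count j as ≡ 2 × count (suc j) as ≡ 0 × (∀ v → v ≢ j → v ≢ suc j → count v as ≡ count v (spots n))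
multiplicities {n} {j} {as} 1≤j 1+j≤n shift = count-j , count-1+j , count-other
  where
  open ≡-Reasoning
  count-j : count j as ≡ 2
  count-j = begin
    count j as                   ≡⟨ count-∷-≢ as (1+n≢n {j} ∘ sym) ⟨
    count j (suc j ∷ as)         ≡⟨ counts shift j ⟩
    count j (j ∷ spots n)        ≡⟨ count-∷-≡ {j} (spots n) refl ⟩
    suc (count j (spots n))      ≡⟨ cong suc (count-spots n 1≤j (<⇒≤ 1+j≤n)) ⟩
    2                            ∎
  count-1+j : count (suc j) as ≡ 0
  count-1+j = suc-injective (begin
    suc (count (suc j) as)       ≡⟨ count-∷-≡ {suc j} as refl ⟨
    count (suc j) (suc j ∷ as)   ≡⟨ counts shift (suc j) ⟩
    count (suc j) (j ∷ spots n)  ≡⟨ count-∷-≢ (spots n) 1+n≢n ⟩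
    count (suc j) (spots n)      ≡⟨ count-spots n (s≤s z≤n) 1+j≤n ⟩
    1                            ∎)
  count-other : ∀ v → v ≢ j → v ≢ suc j → count v as ≡ count v (spots n)
  count-other v v≢j v≢1+j = begin
    count v as                   ≡⟨ count-∷-≢ as v≢1+j ⟨
    count v (suc j ∷ as)         ≡⟨ counts shift v ⟩
    count v (j ∷ spots n)        ≡⟨ count-∷-≢ (spots n) v≢j ⟩
    count v (spots n)            ∎

Parks⇒PF1Multiset : ∀ {n as} → InRange n as → length as ≡ n → Parks n [] as 1 → PF1Multiset n as
Parks⇒PF1Multiset {n} {as} asIn len (ps , parked , disp)
  with parkFrom-outcome asIn parked | parkFrom-displacement-1 parked disp
... | _ , _ , _ , _ | j , inj₁ () , _
... | len′ , psIn , distinct , _ | j , inj₂ j∈ps , shift =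
  j , (proj₁ (psIn j j∈ps) , proj₂ (spots-InRange n (suc j) (≈-∷⇒∈ shift′ 1+n≢n))) , shift′
  where
  ps≈spots : ps ≈ spots n
  ps≈spots = count-≤⇒≈ n psIn (spots-InRange n) (trans len′ (trans len (sym (length-spots n))))
               (λ v 1≤v v≤n → ≤-trans (distinct v) (≤-reflexive (sym (count-spots n 1≤v v≤n))))
  shift′ : suc j ∷ as ≈ j ∷ spots n
  shift′ = ≈-trans shift (∷-cong ps≈spots)

PF1Multiset⇒Parks : ∀ {n as} → InRange n as → PF1Multiset n as → Parks n [] as 1
PF1Multiset⇒Parks {n} {as} asIn (j , (1≤j , 1+j≤n) , shift)
  with multiplicities 1≤j 1+j≤n shift
... | count-j , count-1+j , count-other = park [] as 2 count-j (two (λ ()) (λ ())) asIn free distinct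
  where
  open Simulation n j 1+j≤n
  free : OthersFree as []
  free a a∈ _ = (λ { refl → contradiction (subst (1 ≤_) count-1+j (count-∈ a∈)) λ () }) , λ ()
  distinct : OthersDistinct as
  distinct a a≢j with a ≟ suc j
  ... | yes refl = ≤-trans (≤-reflexive count-1+j) z≤n
  ... | no a≢1+j = ≤-trans (≤-reflexive (count-other a a≢j a≢1+j)) (count-spots-≤1 a n)

AttainedOnlyAt : ∀ {m} → (Fin m → ℕ) → ℕ → Fin m → Set
AttainedOnlyAt f v k = f k ≡ v × (∀ i → i ≢ k → f i ≢ v)

AttainedOnlyAt₂ : ∀ {m} → (Fin m → ℕ) → ℕ → Fin m → Fin m → Set
AttainedOnlyAt₂ f v k k′ = k ≢ k′ × f k ≡ v × f k′ ≡ v × (∀ i → i ≢ k → i ≢ k′ → f i ≢ v)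

count-tabulate-0 : ∀ {m} (f : Fin m → ℕ) {v} → (∀ i → f i ≢ v) → count v (tabulate f) ≡ 0
count-tabulate-0 f never = count-∉ λ v∈ → let (i , v≡fi) = ∈-tabulate⁻ v∈ in never i (sym v≡fi)

count-tabulate-0⁻ : ∀ {m} (f : Fin m → ℕ) {v} → count v (tabulate f) ≡ 0 → ∀ i → f i ≢ v
count-tabulate-0⁻ f none i refl = contradiction (subst (1 ≤_) none (count-∈ (∈-tabulate⁺ i))) λ ()

count-tabulate-1 : ∀ {m} (f : Fin m → ℕ) {v} k → AttainedOnlyAt f v k → count v (tabulate f) ≡ 1
count-tabulate-1 f fzero (fk , others) =
  trans (count-∷-≡ (tabulate (f ∘ fsuc)) (sym fk))
        (cong suc (count-tabulate-0 (f ∘ fsuc) λ i → others (fsuc i) λ ()))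
count-tabulate-1 f (fsuc k) (fk , others) =
  trans (count-∷-≢ (tabulate (f ∘ fsuc)) (others fzero (λ ()) ∘ sym))
        (count-tabulate-1 (f ∘ fsuc) k (fk , λ i i≢k → others (fsuc i) (i≢k ∘ Fin.suc-injective)))

count-tabulate-1⁻ : ∀ {m} (f : Fin m → ℕ) {v} → count v (tabulate f) ≡ 1 → ∃ (AttainedOnlyAt f v)
count-tabulate-1⁻ {suc m} f {v} once with v ≟ f fzero
... | yes v≡f0 = fzero , sym v≡f0 , λ
  { fzero    0≢0 → contradiction refl 0≢0
  ; (fsuc i) _   → count-tabulate-0⁻ (f ∘ fsuc)
                       (suc-injective (trans (sym (count-∷-≡ (tabulate (f ∘ fsuc)) v≡f0)) once)) i }
... | no  v≢f0
  with count-tabulate-1⁻ (f ∘ fsuc) (trans (sym (count-∷-≢ (tabulate (f ∘ fsuc)) v≢f0)) once)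
...   | k , fk , others = fsuc k , fk , λ
  { fzero    _   f0≡v → v≢f0 (sym f0≡v)
  ; (fsuc i) i≢k      → others i (i≢k ∘ cong fsuc) }

count-tabulate-2 : ∀ {m} (f : Fin m → ℕ) {v} k k′ → AttainedOnlyAt₂ f v k k′ → count v (tabulate f) ≡ 2
count-tabulate-2 f fzero    fzero     (k≢k′ , _) = contradiction refl k≢k′
count-tabulate-2 f fzero    (fsuc k′) (_ , fk , fk′ , others) =
  trans (count-∷-≡ (tabulate (f ∘ fsuc)) (sym fk))
        (cong suc (count-tabulate-1 (f ∘ fsuc) k′
          (fk′ , λ i i≢k′ → others (fsuc i) (λ ()) (i≢k′ ∘ Fin.suc-injective))))
count-tabulate-2 f (fsuc k) fzero     (_ , fk , fk′ , others) =
  trans (count-∷-≡ (tabulate (f ∘ fsuc)) (sym fk′))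
        (cong suc (count-tabulate-1 (f ∘ fsuc) k
          (fk , λ i i≢k → others (fsuc i) (i≢k ∘ Fin.suc-injective) (λ ()))))
count-tabulate-2 f (fsuc k) (fsuc k′) (k≢k′ , fk , fk′ , others) =
  trans (count-∷-≢ (tabulate (f ∘ fsuc)) (others fzero (λ ()) (λ ()) ∘ sym))
        (count-tabulate-2 (f ∘ fsuc) k k′ (k≢k′ ∘ cong fsuc , fk , fk′ ,
           λ i i≢k i≢k′ → others (fsuc i) (i≢k ∘ Fin.suc-injective) (i≢k′ ∘ Fin.suc-injective)))

count-tabulate-2⁻ : ∀ {m} (f : Fin m → ℕ) {v} → count v (tabulate f) ≡ 2 → ∃₂ (AttainedOnlyAt₂ f v)
count-tabulate-2⁻ {suc m} f {v} twice with v ≟ f fzero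
... | yes v≡f0
  with count-tabulate-1⁻ (f ∘ fsuc)
         (suc-injective (trans (sym (count-∷-≡ (tabulate (f ∘ fsuc)) v≡f0)) twice))
...   | k , fk , others = fzero , fsuc k , (λ ()) , sym v≡f0 , fk , λ
  { fzero    0≢0 _    → contradiction refl 0≢0
  ; (fsuc i) _   i≢k  → others i (i≢k ∘ cong fsuc) }
count-tabulate-2⁻ {suc m} f {v} twice | no v≢f0
  with count-tabulate-2⁻ (f ∘ fsuc) (trans (sym (count-∷-≢ (tabulate (f ∘ fsuc)) v≢f0)) twice)
... | k , k′ , k≢k′ , fk , fk′ , others = fsuc k , fsuc k′ , k≢k′ ∘ Fin.suc-injective , fk , fk′ , λ
  { fzero    _   _    f0≡v → v≢f0 (sym f0≡v)
  ; (fsuc i) i≢k i≢k′      → others i (i≢k ∘ cong fsuc) (i≢k′ ∘ cong fsuc) }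

Condition₁ : (n : ℕ) → (Fin n → ℕ) → ℕ → Fin n → Fin n → Set
Condition₁ n α j k k′ = (1 ≤ j × j ≤ n ∸ 1) × AttainedOnlyAt₂ α j k k′

Condition₂ : (n : ℕ) → (Fin n → ℕ) → ℕ → Fin n → Fin n → Set
Condition₂ n α j k k′ =
  ∀ v → (∃[ i ] (i ≢ k × i ≢ k′ × α i ≡ v)) ⇔ (1 ≤ v × v ≤ n × v ≢ j × v ≢ suc j)

1+m≤n⇒m≤n∸1 : ∀ {m n} → suc m ≤ n → m ≤ n ∸ 1
1+m≤n⇒m≤n∸1 (s≤s m≤n) = m≤n

m≤n∸1⇒1+m≤n : ∀ {m n} → 1 ≤ m → m ≤ n ∸ 1 → suc m ≤ n
m≤n∸1⇒1+m≤n {n = zero}  1≤m m≤0 = contradiction (≤-trans 1≤m m≤0) λ ()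
m≤n∸1⇒1+m≤n {n = suc n} _   m≤n = s≤s m≤n

PF1Multiset⇒conditions : ∀ {n} {α : Fin n → ℕ} → (∀ i → 1 ≤ α i × α i ≤ n) →
  PF1Multiset n (tabulate α) → ∃[ j ] ∃[ k ] ∃[ k′ ] Condition₁ n α j k k′ × Condition₂ n α j k k′
PF1Multiset⇒conditions {n} {α} α-in (j , (1≤j , 1+j≤n) , shift)
  with multiplicities 1≤j 1+j≤n shift
... | count-j , count-1+j , count-other with count-tabulate-2⁻ α count-j
...   | k , k′ , attained@(_ , αk , αk′ , others) =
  j , k , k′ , ((1≤j , 1+m≤n⇒m≤n∸1 1+j≤n) , attained) , λ v → mk⇔ (to v) (from v)
  where
  to : ∀ v → ∃[ i ] (i ≢ k × i ≢ k′ × α i ≡ v) → 1 ≤ v × v ≤ n × v ≢ j × v ≢ suc j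
  to v (i , i≢k , i≢k′ , refl) =
    proj₁ (α-in i) , proj₂ (α-in i) , others i i≢k i≢k′ ,
    λ αi≡1+j → count-tabulate-0⁻ α count-1+j i αi≡1+j
  from : ∀ v → 1 ≤ v × v ≤ n × v ≢ j × v ≢ suc j → ∃[ i ] (i ≢ k × i ≢ k′ × α i ≡ v)
  from v (1≤v , v≤n , v≢j , v≢1+j) with ∈-tabulate⁻ v∈
    where
    v∈ : v ∈ tabulate α
    v∈ = count⇒∈ (≤-reflexive (sym (trans (count-other v v≢j v≢1+j) (count-spots n 1≤v v≤n))))
  ... | i , v≡αi = i , (λ { refl → v≢j (trans v≡αi αk) }) , (λ { refl → v≢j (trans v≡αi αk′) }) , sym v≡αi

conditions⇒PF1Multiset : ∀ {n} {α : Fin n → ℕ} → (∀ i → 1 ≤ α i × α i ≤ n) →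
  (∃[ j ] ∃[ k ] ∃[ k′ ] Condition₁ n α j k k′ × Condition₂ n α j k k′) → PF1Multiset n (tabulate α)
conditions⇒PF1Multiset {n} {α} α-in
  (j , k , k′ , ((1≤j , j≤n∸1) , attained@(_ , αk , αk′ , others)) , condition₂) =
  j , (1≤j , 1+j≤n) , ≈-sym (count-≤⇒≈ n (InRange-∷ j-in (spots-InRange n))
                        (InRange-∷ (s≤s z≤n , 1+j≤n) (InRange-tabulate α-in))
                        (cong suc (trans (length-spots n) (sym (length-tabulate α)))) below)
  where
  1+j≤n : suc j ≤ n
  1+j≤n = m≤n∸1⇒1+m≤n 1≤j j≤n∸1
  j-in : 1 ≤ j × j ≤ n
  j-in = 1≤j , <⇒≤ 1+j≤n
  count-j : count j (tabulate α) ≡ 2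
  count-j = count-tabulate-2 α k k′ attained
  covered : ∀ v → 1 ≤ v → v ≤ n → v ≢ j → v ≢ suc j → 1 ≤ count v (tabulate α)
  covered v 1≤v v≤n v≢j v≢1+j with Equivalence.from (condition₂ v) (1≤v , v≤n , v≢j , v≢1+j)
  ... | i , _ , _ , refl = count-∈ (∈-tabulate⁺ i)
  below : ∀ v → 1 ≤ v → v ≤ n → count v (j ∷ spots n) ≤ count v (suc j ∷ tabulate α)
  below v 1≤v v≤n with v ≟ j | v ≟ suc j
  ... | yes refl | _ = ≤-reflexive (begin
    count j (j ∷ spots n)            ≡⟨ count-∷-≡ {j} (spots n) refl ⟩
    suc (count j (spots n))          ≡⟨ cong suc (count-spots n 1≤v v≤n) ⟩
    2                                ≡⟨ count-j ⟨
    count j (tabulate α)             ≡⟨ count-∷-≢ {j} (tabulate α) (1+n≢n ∘ sym) ⟨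
    count j (suc j ∷ tabulate α)     ∎)
    where open ≡-Reasoning
  ... | no v≢j | yes refl = begin
    count v (j ∷ spots n)            ≡⟨ count-∷-≢ {v} (spots n) v≢j ⟩
    count v (spots n)                ≡⟨ count-spots n 1≤v v≤n ⟩
    1                                ≤⟨ s≤s z≤n ⟩
    suc (count v (tabulate α))       ≡⟨ count-∷-≡ {v} (tabulate α) refl ⟨
    count v (suc j ∷ tabulate α)     ∎
    where open ≤-Reasoning
  ... | no v≢j | no v≢1+j = begin
    count v (j ∷ spots n)            ≡⟨ count-∷-≢ {v} (spots n) v≢j ⟩
    count v (spots n)                ≡⟨ count-spots n 1≤v v≤n ⟩
    1                                ≤⟨ covered v 1≤v v≤n v≢j v≢1+j ⟩
    count v (tabulate α)             ≡⟨ count-∷-≢ {v} (tabulate α) v≢1+j ⟨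
    count v (suc j ∷ tabulate α)     ∎
    where open ≤-Reasoning

theorem2 : (n : ℕ) → (α : Fin n → ℕ) → (∀ i → 1 ≤ α i × α i ≤ n) →
    PF1 n α ⇔
      (∃[ j ] ∃[ k ] ∃[ k′ ]
        ((1 ≤ j × j ≤ n ∸ 1) × k ≢ k′ × α k ≡ j × α k′ ≡ j ×
         (∀ i → i ≢ k → i ≢ k′ → α i ≢ j)) ×
        (∀ v → (∃[ i ] (i ≢ k × i ≢ k′ × α i ≡ v)) ⇔
               (1 ≤ v × v ≤ n × v ≢ j × v ≢ suc j)))
theorem2 n α α-in = ⇔.trans
  (mk⇔ (Parks⇒PF1Multiset αIn (length-tabulate α)) (PF1Multiset⇒Parks αIn))
  (mk⇔ (PF1Multiset⇒conditions α-in) (conditions⇒PF1Multiset α-in))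
  where
  αIn : InRange n (tabulate α)
  αIn = InRange-tabulate α-in
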